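{- Let $G$ be a graph on $n$ vertices with ${\rm diam}(G)=3$. If there exists a maximal independent set $A$ of $G$ with $|A|=i(G)$ such that $D(G)-A$ has an isolated vertex, then $\Gamma_{\rho}(G)=n-i(G)+1$.
   Context: Graphs are finite and simple; $d(u,v)$ is the distance in $G$. $i(G)$ is the minimum cardinality of a maximal independent set of $G$. The diametrical graph $D(G)$ has vertex set $V(G)$, with $x,y$ adjacent iff $d(x,y)={\rm diam}(G)$; $D(G)-A$ is obtained by deleting the vertices of $A$. A packing coloring $c:V(G)\to\{1,\dots,k\}$ satisfies: $c(u)=c(v)=i$, $u\ne v$, implies $d(u,v)>i$. The Grundy packing chromatic number $\Gamma_{\rho}(G)$ is the maximum number of colors $k$ in a packing coloring $c:V(G)\to\{1,\dots,k\}$ using all $k$ colors in which every vertex $v$ with $c(v)=i$ has, for every $j\in\{1,\dots,i-1\}$, a vertex $u$ with $c(u)=j$ and $d(u,v)\le j$ (equivalently, the maximum number of colors produced by the greedy procedure that processes vertices in some order and assigns each vertex the smallest color $i$ with no already-colored vertex of color $i$ at distance at most $i$). -}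

module Defs where

open import Data.Nat using (ℕ; zero; suc; _+_; _∸_; _≤_; _<_)
open import Data.Fin using (Fin)
open import Data.Fin.Subset using (Subset; _∈_; _∉_; ∣_∣)
open import Data.Product using (Σ; ∃; ∃-syntax; _×_; _,_)
open import Relation.Nullary using (¬_)
open import Relation.Binary using (Decidable)
open import Relation.Binary.PropositionalEquality using (_≡_; _≢_)

record Graph (n : ℕ) : Set₁ where
  field
    Adj     : Fin n → Fin n → Set
    adj?    : Decidable Adj
    sym     : ∀ {u v} → Adj u v → Adj v u
    irrefl  : ∀ {u} → ¬ Adj u u

open Graph public

module _ {n : ℕ} (G : Graph n) where

  data Walk : Fin n → Fin n → ℕ → Set where
    here : ∀ {u} → Walk u u zero
    step : ∀ {u w v k} → Adj G u w → Walk w v k → Walk u v (suc k)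

  DistLe : Fin n → Fin n → ℕ → Set
  DistLe u v k = ∃[ m ] (m ≤ k × Walk u v m)

  HasDist : Fin n → Fin n → ℕ → Set
  HasDist u v d = Walk u v d × (∀ m → m < d → ¬ Walk u v m)

  Diam : ℕ → Set
  Diam d = (∀ u v → DistLe u v d) × (∃[ u ] ∃[ v ] HasDist u v d)

  Independent : Subset n → Set
  Independent A = ∀ u v → u ∈ A → v ∈ A → ¬ Adj G u v

  MaximalIndependent : Subset n → Set
  MaximalIndependent A =
    Independent A × (∀ v → v ∉ A → ∃[ u ] (u ∈ A × Adj G u v))

  MinMaximalIndependent : Subset n → Set
  MinMaximalIndependent A =
    MaximalIndependent A × (∀ B → MaximalIndependent B → ∣ A ∣ ≤ ∣ B ∣)

  -- v is an isolated vertex of D(G) - A (the diametrical graph, diam(G) = d,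
  -- with the vertices of A deleted): v ∉ A and no w ∉ A is at distance d from v.
  IsolatedInDiamMinus : ℕ → Subset n → Fin n → Set
  IsolatedInDiamMinus d A v = v ∉ A × (∀ w → w ∉ A → ¬ HasDist v w d)

  ColoringOnto : ℕ → (Fin n → ℕ) → Set
  ColoringOnto k c =
    (∀ v → 1 ≤ c v × c v ≤ k) × (∀ j → 1 ≤ j → j ≤ k → ∃[ v ] c v ≡ j)

  Packing : (Fin n → ℕ) → Set
  Packing c = ∀ u v → u ≢ v → c u ≡ c v → ¬ DistLe u v (c u)

  GrundyCond : (Fin n → ℕ) → Set
  GrundyCond c = ∀ v j → 1 ≤ j → j < c v → ∃[ u ] (c u ≡ j × DistLe u v j)

  GrundyPackingColoring : ℕ → (Fin n → ℕ) → Set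
  GrundyPackingColoring k c = ColoringOnto k c × Packing c × GrundyCond c

  GrundyPackingNumber : ℕ → Set
  GrundyPackingNumber k =
    (∃[ c ] GrundyPackingColoring k c)
    × (∀ k' c → GrundyPackingColoring k' c → k' ≤ k)

{-# OPTIONS --safe #-}
-- Upper bound: in a Grundy packing colouring the colour-1 class is a maximal
-- independent set (independent by the packing condition, dominating by the
-- Grundy condition), so it has at least i(G) vertices, and each further colour
-- needs a vertex of its own: at most n - i(G) + 1 colours.
-- Lower bound: colour A with 1, the isolated vertex v of D(G) - A with 2 and the
-- other n - i(G) - 1 vertices with distinct colours 3, 4, ….  Vertices outside A
-- have a neighbour in A; every other vertex outside A is within distance 2 of v
-- since its distance to v is at most diam(G) = 3 but not 3; and colours ≥ 3 are
-- always within reach as all distances are at most 3.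
module Submission where

open import Defs hiding (sym)
open import Data.Nat using (ℕ; zero; suc; _+_; _∸_; _≤_; _<_; z≤n; s≤s)
import Data.Nat.Properties as ℕ
open import Data.Fin using (Fin; toℕ; fromℕ<) renaming (zero to fzero; suc to fsuc)
open import Data.Fin.Properties using (any?; toℕ-fromℕ<; toℕ<n; toℕ-injective; injective⇒≤)
  renaming (_≟_ to _≟ᶠ_)
open import Data.Fin.Subset using (Subset; _∈_; _∉_; ∣_∣; ∁; _-_; _─_; ⁅_⁆; inside; outside)
open import Data.Fin.Subset.Properties
  using (_∈?_; p─⊥≡p; p─q⊆p; x∈p∧x≢y⇒x∈p-y; x∈⁅x⁆; x∉p⇒x∈∁p; x∈∁p⇒x∉p; ∣∁p∣≡n∸∣p∣)
open import Data.Vec using (_∷_; here; there; tabulate)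
open import Data.Vec.Properties using (lookup∘tabulate; []=⇒lookup; lookup⇒[]=)
open import Data.Product using (∃-syntax; _×_; _,_; proj₁; proj₂)
open import Data.Sum using (_⊎_; inj₁; inj₂)
open import Data.Empty using (⊥-elim)
open import Function using (_∘_; case_of_)
open import Function.Definitions using (Injective)
open import Relation.Nullary using (¬_; Dec; yes; no; does)
open import Relation.Nullary.Decidable using (_×-dec_; map′; dec-true)
open import Relation.Unary using (Pred; Decidable)
open import Relation.Binary.PropositionalEquality
  using (_≡_; _≢_; refl; sym; trans; cong; subst; module ≡-Reasoning)

rank : ∀ {n} → Subset n → Fin n → ℕ
rank (_ ∷ p)       fzero    = 0
rank (inside ∷ p)  (fsuc x) = suc (rank p x)
rank (outside ∷ p) (fsuc x) = rank p x

rank<∣p∣ : ∀ {n} {p : Subset n} {x} → x ∈ p → rank p x < ∣ p ∣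
rank<∣p∣ here = s≤s z≤n
rank<∣p∣ {p = inside ∷ p}  (there x∈p) = s≤s (rank<∣p∣ x∈p)
rank<∣p∣ {p = outside ∷ p} (there x∈p) = rank<∣p∣ x∈p

rank-injective : ∀ {n} {p : Subset n} {x y} → x ∈ p → y ∈ p → rank p x ≡ rank p y → x ≡ y
rank-injective here here _ = refl
rank-injective here (there {x = inside} _) ()
rank-injective (there {x = inside} _) here ()
rank-injective {p = inside ∷ p} (there x∈p) (there y∈p) eq =
  cong fsuc (rank-injective x∈p y∈p (ℕ.suc-injective eq))
rank-injective {p = outside ∷ p} (there x∈p) (there y∈p) eq =
  cong fsuc (rank-injective x∈p y∈p eq)

rank-surjective : ∀ {n} (p : Subset n) {r} → r < ∣ p ∣ → ∃[ x ] (x ∈ p × rank p x ≡ r)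
rank-surjective (inside ∷ p) {zero} _ = fzero , here , refl
rank-surjective (inside ∷ p) {suc r} r<∣p∣ with rank-surjective p (ℕ.≤-pred r<∣p∣)
... | x , x∈p , rank≡r = fsuc x , there x∈p , cong suc rank≡r
rank-surjective (outside ∷ p) r<∣p∣ with rank-surjective p r<∣p∣
... | x , x∈p , rank≡r = fsuc x , there x∈p , rank≡r

injective⇒≤∣p∣ : ∀ {m n} {p : Subset n} (f : Fin m → Fin n) →
                 (∀ x → f x ∈ p) → Injective _≡_ _≡_ f → m ≤ ∣ p ∣
injective⇒≤∣p∣ {m} {p = p} f f∈p f-injective = injective⇒≤ g-injective
  where
  g : Fin m → Fin ∣ p ∣
  g x = fromℕ< (rank<∣p∣ (f∈p x))

  g-injective : Injective _≡_ _≡_ g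
  g-injective {x} {y} gx≡gy = f-injective (rank-injective (f∈p x) (f∈p y) (begin
    rank p (f x)  ≡⟨ toℕ-fromℕ< (rank<∣p∣ (f∈p x)) ⟨
    toℕ (g x)     ≡⟨ cong toℕ gx≡gy ⟩
    toℕ (g y)     ≡⟨ toℕ-fromℕ< (rank<∣p∣ (f∈p y)) ⟩
    rank p (f y)  ∎))
    where open ≡-Reasoning

x∈p─q⇒x∉q : ∀ {n} {x : Fin n} (p q : Subset n) → x ∈ p ─ q → x ∉ q
x∈p─q⇒x∉q {x = fzero}  (_ ∷ p) (inside ∷ q)  ()
x∈p─q⇒x∉q {x = fzero}  (_ ∷ p) (outside ∷ q) _ ()
x∈p─q⇒x∉q {x = fsuc x} (_ ∷ p) (_ ∷ q) (there x∈p─q) (there x∈q) =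
  x∈p─q⇒x∉q p q x∈p─q x∈q

∣p-x∣+1≡∣p∣ : ∀ {n} {p : Subset n} {x} → x ∈ p → suc ∣ p - x ∣ ≡ ∣ p ∣
∣p-x∣+1≡∣p∣ {p = inside ∷ p}  here        = cong (suc ∘ ∣_∣) (p─⊥≡p p)
∣p-x∣+1≡∣p∣ {p = inside ∷ p}  (there x∈p) = cong suc (∣p-x∣+1≡∣p∣ x∈p)
∣p-x∣+1≡∣p∣ {p = outside ∷ p} (there x∈p) = ∣p-x∣+1≡∣p∣ x∈p

module _ {n ℓ} {P : Pred (Fin n) ℓ} (P? : Decidable P) where

  subsetOf : Subset n
  subsetOf = tabulate (does ∘ P?)

  ∈subsetOf⁺ : ∀ {x} → P x → x ∈ subsetOf
  ∈subsetOf⁺ {x} px =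
    lookup⇒[]= x subsetOf (trans (lookup∘tabulate (does ∘ P?) x) (dec-true (P? x) px))

  ∈subsetOf⁻ : ∀ {x} → x ∈ subsetOf → P x
  ∈subsetOf⁻ {x} x∈ with P? x | trans (sym (lookup∘tabulate (does ∘ P?) x)) ([]=⇒lookup x∈)
  ... | yes px | _ = px
  ... | no _   | ()

colourClass : ∀ {n} → (Fin n → ℕ) → ℕ → Subset n
colourClass c j = subsetOf (λ u → c u ℕ.≟ j)

∈colourClass⁺ : ∀ {n} (c : Fin n → ℕ) {j u} → c u ≡ j → u ∈ colourClass c j
∈colourClass⁺ c {j} = ∈subsetOf⁺ (λ u → c u ℕ.≟ j)

∈colourClass⁻ : ∀ {n} (c : Fin n → ℕ) {j u} → u ∈ colourClass c j → c u ≡ j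
∈colourClass⁻ c {j} = ∈subsetOf⁻ (λ u → c u ℕ.≟ j)

module _ {n : ℕ} (G : Graph n) where

  walk? : ∀ u w k → Dec (Walk G u w k)
  walk? u w zero    = map′ (λ { refl → here }) (λ { here → refl }) (u ≟ᶠ w)
  walk? u w (suc k) = map′ (λ (x , a , W) → step a W) (λ { (step a W) → _ , a , W })
                           (any? (λ x → adj? G u x ×-dec walk? x w k))

  adj⇒distLe1 : ∀ {u w} → Adj G u w → DistLe G u w 1
  adj⇒distLe1 a = 1 , ℕ.≤-refl , step a here

  distLe1⇒≡⊎adj : ∀ {u w} → DistLe G u w 1 → u ≡ w ⊎ Adj G u w
  distLe1⇒≡⊎adj (zero , _ , here)              = inj₁ refl
  distLe1⇒≡⊎adj (suc zero , _ , step a here)   = inj₂ a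
  distLe1⇒≡⊎adj (suc (suc _) , s≤s () , _)

  distLe-mono : ∀ {u w d d′} → d ≤ d′ → DistLe G u w d → DistLe G u w d′
  distLe-mono d≤d′ (m , m≤d , W) = m , ℕ.≤-trans m≤d d≤d′ , W

  distLe-pred : ∀ {u w d} → DistLe G u w (suc d) → ¬ HasDist G u w (suc d) → DistLe G u w d
  distLe-pred {u} {w} {d} (m , m≤1+d , W) ¬dist
    with any? {n = suc d} (λ i → walk? u w (toℕ i))
  ... | yes (i , Wᵢ) = toℕ i , ℕ.≤-pred (toℕ<n i) , Wᵢ
  ... | no ¬short    = ⊥-elim (¬dist (subst (Walk G u w) m≡1+d W , noShort))
    where
    noShort : ∀ m′ → m′ < suc d → ¬ Walk G u w m′
    noShort m′ m′<1+d W′ =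
      ¬short (fromℕ< m′<1+d , subst (Walk G u w) (sym (toℕ-fromℕ< m′<1+d)) W′)

    m≡1+d : m ≡ suc d
    m≡1+d = ℕ.≤-antisym m≤1+d (ℕ.≮⇒≥ λ m<1+d → noShort m m<1+d W)

  packing-if-injective-above-1 : (c : Fin n → ℕ) →
    (∀ u w → c u ≡ 1 → c w ≡ 1 → ¬ Adj G u w) →
    (∀ u w → c u ≡ c w → c u ≢ 1 → u ≡ w) →
    Packing G c
  packing-if-injective-above-1 c independent injective u w u≢w cu≡cw d with c u ℕ.≟ 1
  ... | no cu≢1 = u≢w (injective u w cu≡cw cu≢1)
  ... | yes cu≡1 with distLe1⇒≡⊎adj (subst (DistLe G u w) cu≡1 d)
  ...   | inj₁ u≡w = u≢w u≡w
  ...   | inj₂ a   = independent u w cu≡1 (trans (sym cu≡cw) cu≡1) a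

  grundy-if-diam≤3 : ∀ {k c} → (∀ u w → DistLe G u w 3) → ColoringOnto G k c →
    (∀ w → 1 < c w → ∃[ u ] (c u ≡ 1 × DistLe G u w 1)) →
    (∀ w → 2 < c w → ∃[ u ] (c u ≡ 2 × DistLe G u w 2)) →
    GrundyCond G c
  grundy-if-diam≤3 _ _ _ _ w zero ()
  grundy-if-diam≤3 _ _ colour1-nearby _ w 1 _ 1<cw = colour1-nearby w 1<cw
  grundy-if-diam≤3 _ _ _ colour2-nearby w 2 _ 2<cw = colour2-nearby w 2<cw
  grundy-if-diam≤3 diam≤3 (bounds , onto) _ _ w j@(suc (suc (suc _))) 1≤j j<cw
    with onto j 1≤j (ℕ.<⇒≤ (ℕ.<-≤-trans j<cw (proj₂ (bounds w))))
  ... | u , cu≡j = u , cu≡j , distLe-mono (s≤s (s≤s (s≤s z≤n))) (diam≤3 u w)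

  colourClass1-maximalIndependent : ∀ {k c} → GrundyPackingColoring G k c →
                                    MaximalIndependent G (colourClass c 1)
  colourClass1-maximalIndependent {c = c} ((bounds , _) , packing , grundy) = independent , dominating
    where
    independent : Independent G (colourClass c 1)
    independent u w u∈ w∈ a = packing u w (λ { refl → irrefl G a })
      (trans (∈colourClass⁻ c u∈) (sym (∈colourClass⁻ c w∈)))
      (subst (DistLe G u w) (sym (∈colourClass⁻ c u∈)) (adj⇒distLe1 a))

    dominating : ∀ w → w ∉ colourClass c 1 → ∃[ u ] (u ∈ colourClass c 1 × Adj G u w)
    dominating w w∉ with grundy w 1 ℕ.≤-refl (ℕ.≤∧≢⇒< (proj₁ (bounds w)) (w∉ ∘ ∈colourClass⁺ c ∘ sym))
    ... | u , cu≡1 , d with distLe1⇒≡⊎adj d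
    ...   | inj₁ refl = ⊥-elim (w∉ (∈colourClass⁺ c cu≡1))
    ...   | inj₂ a    = u , ∈colourClass⁺ c cu≡1 , a

  colours≤∣∁colourClass1∣ : ∀ {k c} → ColoringOnto G (suc k) c → k ≤ ∣ ∁ (colourClass c 1) ∣
  colours≤∣∁colourClass1∣ {k} {c} (_ , onto) = injective⇒≤∣p∣ f f∉class1 f-injective
    where
    f : Fin k → Fin n
    f x = proj₁ (onto (2 + toℕ x) (s≤s z≤n) (s≤s (toℕ<n x)))

    cf : ∀ x → c (f x) ≡ 2 + toℕ x
    cf x = proj₂ (onto (2 + toℕ x) (s≤s z≤n) (s≤s (toℕ<n x)))

    f∉class1 : ∀ x → f x ∈ ∁ (colourClass c 1)
    f∉class1 x = x∉p⇒x∈∁p λ fx∈ → case trans (sym (cf x)) (∈colourClass⁻ c fx∈) of λ ()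

    f-injective : Injective _≡_ _≡_ f
    f-injective {x} {y} fx≡fy =
      toℕ-injective (ℕ.+-cancelˡ-≡ 2 _ _ (trans (sym (cf x)) (trans (cong c fx≡fy) (cf y))))

  grundyPacking-colours≤ : ∀ {i k c} → (∀ B → MaximalIndependent G B → i ≤ ∣ B ∣) →
                           GrundyPackingColoring G k c → k ≤ n ∸ i + 1
  grundyPacking-colours≤ {k = zero} _ _ = z≤n
  grundyPacking-colours≤ {i} {suc k} {c} minimal colouring@(onto , _) = begin
    suc k            ≤⟨ s≤s (colours≤∣∁colourClass1∣ onto) ⟩
    suc ∣ ∁ C₁ ∣      ≡⟨ cong suc (∣∁p∣≡n∸∣p∣ C₁) ⟩
    suc (n ∸ ∣ C₁ ∣)  ≤⟨ s≤s (ℕ.∸-monoʳ-≤ n (minimal C₁ (colourClass1-maximalIndependent colouring))) ⟩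
    suc (n ∸ i)      ≡⟨ ℕ.+-comm 1 (n ∸ i) ⟩
    n ∸ i + 1        ∎
    where
    open ℕ.≤-Reasoning
    C₁ : Subset n
    C₁ = colourClass c 1

module IsolatedVertexColouring {n : ℕ} (G : Graph n) (diam≤3 : ∀ u w → DistLe G u w 3)
  {A : Subset n} (A-maximalIndependent : MaximalIndependent G A)
  {v : Fin n} (v∉A : v ∉ A) (v-isolated : ∀ w → w ∉ A → ¬ HasDist G v w 3) where

  S : Subset n
  S = ∁ A - v

  ∈S⇒∉A : ∀ {u} → u ∈ S → u ∉ A
  ∈S⇒∉A u∈S = x∈∁p⇒x∉p (p─q⊆p (∁ A) ⁅ v ⁆ u∈S)

  ∈S⇒≢v : ∀ {u} → u ∈ S → u ≢ v
  ∈S⇒≢v u∈S refl = x∈p─q⇒x∉q (∁ A) ⁅ v ⁆ u∈S (x∈⁅x⁆ v)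

  data Part (u : Fin n) : Set where
    inA : u ∈ A → Part u
    isV : u ≡ v → Part u
    inS : u ∈ S → Part u

  part : ∀ u → Part u
  part u with u ∈? A | u ≟ᶠ v
  ... | yes u∈A | _       = inA u∈A
  ... | no _    | yes u≡v = isV u≡v
  ... | no u∉A  | no u≢v  = inS (x∈p∧x≢y⇒x∈p-y (x∉p⇒x∈∁p u∉A) u≢v)

  colourOf : ∀ {u} → Part u → ℕ
  colourOf     (inA _) = 1
  colourOf     (isV _) = 2
  colourOf {u} (inS _) = 3 + rank S u

  colour : Fin n → ℕ
  colour u = colourOf (part u)

  colour-A : ∀ {u} → u ∈ A → colour u ≡ 1
  colour-A {u} u∈A with part u
  ... | inA _    = refl
  ... | isV refl = ⊥-elim (v∉A u∈A)
  ... | inS u∈S  = ⊥-elim (∈S⇒∉A u∈S u∈A)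

  colour-v : colour v ≡ 2
  colour-v with part v
  ... | inA v∈A = ⊥-elim (v∉A v∈A)
  ... | isV _   = refl
  ... | inS v∈S = ⊥-elim (∈S⇒≢v v∈S refl)

  colour-S : ∀ {u} → u ∈ S → colour u ≡ 3 + rank S u
  colour-S {u} u∈S with part u
  ... | inA u∈A  = ⊥-elim (∈S⇒∉A u∈S u∈A)
  ... | isV refl = ⊥-elim (∈S⇒≢v u∈S refl)
  ... | inS _    = refl

  colour≡1⇒∈A : ∀ {u} → colour u ≡ 1 → u ∈ A
  colour≡1⇒∈A {u} with part u
  ... | inA u∈A = λ _ → u∈A
  ... | isV _   = λ ()
  ... | inS _   = λ ()

  colour-injective-above-1 : ∀ u w → colour u ≡ colour w → colour u ≢ 1 → u ≡ w
  colour-injective-above-1 u w with part u | part w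
  ... | inA _    | _        = λ _ cu≢1 → ⊥-elim (cu≢1 refl)
  ... | isV refl | isV refl = λ _ _ → refl
  ... | isV _    | inA _    = λ ()
  ... | isV _    | inS _    = λ ()
  ... | inS _    | inA _    = λ ()
  ... | inS _    | isV _    = λ ()
  ... | inS u∈S  | inS w∈S  = λ cu≡cw _ → rank-injective u∈S w∈S (ℕ.+-cancelˡ-≡ 3 _ _ cu≡cw)

  colours : ℕ
  colours = 2 + ∣ S ∣

  colours≡n∸∣A∣+1 : colours ≡ n ∸ ∣ A ∣ + 1
  colours≡n∸∣A∣+1 = begin
    2 + ∣ S ∣     ≡⟨ cong suc (∣p-x∣+1≡∣p∣ (x∉p⇒x∈∁p v∉A)) ⟩
    1 + ∣ ∁ A ∣   ≡⟨ cong suc (∣∁p∣≡n∸∣p∣ A) ⟩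
    1 + (n ∸ ∣ A ∣) ≡⟨ ℕ.+-comm 1 (n ∸ ∣ A ∣) ⟩
    n ∸ ∣ A ∣ + 1 ∎
    where open ≡-Reasoning

  onto : ColoringOnto G colours colour
  onto = bounds , surjective
    where
    bounds : ∀ u → 1 ≤ colour u × colour u ≤ colours
    bounds u with part u
    ... | inA _   = s≤s z≤n , s≤s z≤n
    ... | isV _   = s≤s z≤n , s≤s (s≤s z≤n)
    ... | inS u∈S = s≤s z≤n , s≤s (s≤s (rank<∣p∣ u∈S))

    surjective : ∀ j → 1 ≤ j → j ≤ colours → ∃[ u ] colour u ≡ j
    surjective 1 _ _ with proj₂ A-maximalIndependent v v∉A
    ... | u , u∈A , _ = u , colour-A u∈A
    surjective 2 _ _ = v , colour-v
    surjective (suc (suc (suc r))) _ (s≤s (s≤s r<∣S∣)) with rank-surjective S r<∣S∣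
    ... | u , u∈S , rank≡r = u , trans (colour-S u∈S) (cong (3 +_) rank≡r)

  packing : Packing G colour
  packing = packing-if-injective-above-1 G colour
    (λ u w cu≡1 cw≡1 →
      proj₁ A-maximalIndependent u w (colour≡1⇒∈A cu≡1) (colour≡1⇒∈A cw≡1))
    colour-injective-above-1

  colour1-nearby : ∀ w → 1 < colour w → ∃[ u ] (colour u ≡ 1 × DistLe G u w 1)
  colour1-nearby w 1<cw
    with proj₂ A-maximalIndependent w (λ w∈A → ℕ.<-irrefl refl (subst (1 <_) (colour-A w∈A) 1<cw))
  ... | u , u∈A , a = u , colour-A u∈A , adj⇒distLe1 G a

  colour2-nearby : ∀ w → 2 < colour w → ∃[ u ] (colour u ≡ 2 × DistLe G u w 2)
  colour2-nearby w with part w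
  ... | inA _   = λ { (s≤s ()) }
  ... | isV _   = λ { (s≤s (s≤s ())) }
  ... | inS w∈S = λ _ → v , colour-v , distLe-pred G (diam≤3 v w) (v-isolated w (∈S⇒∉A w∈S))

  isGrundyPacking : GrundyPackingColoring G colours colour
  isGrundyPacking = onto , packing , grundy-if-diam≤3 G diam≤3 onto colour1-nearby colour2-nearby

corollary14 : (n : ℕ) (G : Graph n) → Diam G 3 →
    (A : Subset n) → MinMaximalIndependent G A →
    (∃[ v ] IsolatedInDiamMinus G 3 A v) →
    GrundyPackingNumber G (n ∸ ∣ A ∣ + 1)
corollary14 n G (diam≤3 , _) A (A-maximalIndependent , A-minimum) (v , v∉A , v-isolated) =
  (colour , subst (λ k → GrundyPackingColoring G k colour) colours≡n∸∣A∣+1 isGrundyPacking) ,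
  λ _ _ → grundyPacking-colours≤ G A-minimum
  where open IsolatedVertexColouring G diam≤3 A-maximalIndependent v∉A v-isolated
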